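{- Let $R$ be a commutative ring whose group of units $R^\times$ is finite, and let $n,m\ge 1$. Then the number of Pascal-like matrices $M\in R^{n\times m}$ is exactly $(\#R^\times)^{nm}$.
   Context: Index the rows of $M\in R^{n\times m}$ by $0,\dots,n-1$ and columns by $0,\dots,m-1$. A square sub-matrix lying on the upper border is one of the form $M_{[0:k),[j:j+k)}$ (rows $0,\dots,k-1$, columns $j,\dots,j+k-1$), and one lying on the left border is of the form $M_{[i:i+k),[0:k)}$ (rows $i,\dots,i+k-1$, columns $0,\dots,k-1$), with $k\ge 1$ and the index ranges contained in those of $M$. The matrix $M$ is called Pascal-like if every square sub-matrix lying on the upper border or on the left border is invertible over $R$, i.e. has determinant in $R^\times$. -}

module Defs where

open import Level using (_⊔_)
open import Data.Nat as ℕ using (ℕ; zero; suc; _≤_)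
open import Data.Fin using (Fin; zero; suc; inject≤; _↑ʳ_; punchIn)
open import Data.Product using (Σ; ∃; _,_; proj₁; _×_)
open import Algebra.Bundles using (CommutativeRing)
open import Relation.Binary.Bundles using (Setoid)
import Relation.Binary.Construct.On as On

module _ {c ℓ} (R : CommutativeRing c ℓ) where
  open CommutativeRing R using (Carrier; _≈_; _+_; _*_; -_; 0#; 1#; setoid; refl; sym; trans)

  Matrix : ℕ → ℕ → Set c
  Matrix n m = Fin n → Fin m → Carrier

  -- x is a unit of R (R commutative, so a one-sided inverse suffices)
  IsUnit : Carrier → Set (c ⊔ ℓ)
  IsUnit x = ∃ λ y → x * y ≈ 1#

  ∑ : ∀ {k} → (Fin k → Carrier) → Carrier
  ∑ {zero}  f = 0#
  ∑ {suc k} f = f zero + ∑ (λ i → f (suc i))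

  sign : ∀ {k} → Fin k → Carrier
  sign zero    = 1#
  sign (suc i) = - sign i

  det : ∀ {k} → Matrix k k → Carrier
  det {zero}  M = 1#
  det {suc k} M = ∑ λ i → sign i * (M i zero * det (λ a b → M (punchIn i a) (suc b)))

  -- square sub-matrix on the upper border: rows [0,k), columns [j,j+k)
  upperSub : ∀ {n m} → Matrix n m → (k j : ℕ) → k ≤ n → j ℕ.+ k ≤ m → Matrix k k
  upperSub M k j k≤n j+k≤m a b = M (inject≤ a k≤n) (inject≤ (j ↑ʳ b) j+k≤m)

  -- square sub-matrix on the left border: rows [i,i+k), columns [0,k)
  leftSub : ∀ {n m} → Matrix n m → (k i : ℕ) → i ℕ.+ k ≤ n → k ≤ m → Matrix k k
  leftSub M k i i+k≤n k≤m a b = M (inject≤ (i ↑ʳ a) i+k≤n) (inject≤ b k≤m)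

  PascalLike : ∀ {n m} → Matrix n m → Set (c ⊔ ℓ)
  PascalLike {n} {m} M =
    (∀ (k j : ℕ) → 1 ≤ k → (k≤n : k ≤ n) → (j+k≤m : j ℕ.+ k ≤ m) →
       IsUnit (det (upperSub M k j k≤n j+k≤m)))
    × (∀ (k i : ℕ) → 1 ≤ k → (i+k≤n : i ℕ.+ k ≤ n) → (k≤m : k ≤ m) →
       IsUnit (det (leftSub M k i i+k≤n k≤m)))


  Units : Setoid (c ⊔ ℓ) ℓ
  Units = On.setoid setoid (proj₁ {B = IsUnit})

  matrixSetoid : ℕ → ℕ → Setoid c ℓ
  matrixSetoid n m = record
    { Carrier = Matrix n m
    ; _≈_ = λ M N → ∀ i j → M i j ≈ N i j
    ; isEquivalence = record
      { refl = λ i j → refl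
      ; sym = λ p i j → sym (p i j)
      ; trans = λ p q i j → trans (p i j) (q i j) } }

  PascalLikeMatrices : ℕ → ℕ → Setoid (c ⊔ ℓ) ℓ
  PascalLikeMatrices n m =
    On.setoid (matrixSetoid n m) (proj₁ {B = PascalLike {n} {m}})

-- Enumerate the entries of an n × m matrix in row-major order and attach to the entry (i, j)
-- the determinant D(i, j) of the largest square sub-matrix lying on the upper or left border
-- whose bottom-right entry is (i, j). The border squares in the definition of Pascal-like are
-- exactly these, so M is Pascal-like iff every D(i, j) is a unit. Expanding along the corner,
-- D(i, j) = D(i-1, j-1) · M(i, j) + (a polynomial in earlier entries), with D(i-1, j-1) read as 1
-- on the border. So on Pascal-like matrices M ↦ (D(i, j)) is a triangular change of variables
-- with unit diagonal, hence a bijection onto the (R^×)^(n m) families of units.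
module Submission where

open import Defs
open import Level using (Level; _⊔_; Lift; lift)
open import Data.Nat as ℕ using (ℕ; zero; suc; _≤_; _<_; _^_; _∸_; _⊓_; _≟_; NonZero; z≤n; s≤s)
open import Data.Nat.Properties
  using (≤-total; ≤-refl; <⇒≤; <-irrefl; ≤-<-trans; <-trans; n<1+n; +-suc; +-monoʳ-≤; +-monoʳ-<;
         m≤n+m; m≤n⇒m⊓n≡m; m≥n⇒m⊓n≡n; m⊓n≤m; m⊓n≤n; n∸n≡0; m∸n+n≡m; m+n∸n≡m)
open import Data.Nat.DivMod using (_/_; _%_; m%n<n)
open import Data.Fin using (Fin; zero; suc; toℕ; inject₁; fromℕ; fromℕ<; _↑ʳ_; punchIn; opposite; combine; remQuot)
open import Data.Fin.Properties
  using (toℕ<n; toℕ≤pred[n]; inject₁ℕ<; toℕ-fromℕ; toℕ-fromℕ<; toℕ-inject₁; toℕ-inject≤; toℕ-↑ʳ; toℕ-combine;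
         opposite-suc; opposite-involutive; remQuot-combine; combine-remQuot)
open import Data.Product using (Σ; _×_; _,_; proj₁; proj₂; uncurry)
open import Data.Sum using (inj₁; inj₂)
open import Data.Unit using (⊤; tt)
open import Data.Vec.Functional using (Vector; head; tail; _∷_)
open import Algebra.Bundles using (CommutativeRing)
open import Function.Bundles using (Bijection; Inverse)
open import Function.Definitions using (Congruent; StrictlyInverseˡ; StrictlyInverseʳ)
open import Function.Construct.Composition using (inverse)
open import Function.Properties.Bijection using (Bijection⇒Inverse)
open import Function.Properties.Inverse using (Inverse⇒Bijection)
open import Relation.Binary.Bundles using (Setoid)
open import Relation.Nullary using (yes; no; contradiction)
import Relation.Binary.Construct.On as On
import Data.Vec.Functional.Relation.Binary.Equality.Setoid as VecEq
import Function.Consequences.Setoid as Consequences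
import Relation.Binary.PropositionalEquality as ≡
open ≡ using (_≡_)

module _ {a b ℓ₁ ℓ₂} {S : Setoid a ℓ₁} {T : Setoid b ℓ₂} where
  private
    module S = Setoid S
    module T = Setoid T

  mkInverseₛ : (to : S.Carrier → T.Carrier) (from : T.Carrier → S.Carrier) →
    Congruent S._≈_ T._≈_ to → Congruent T._≈_ S._≈_ from →
    StrictlyInverseˡ T._≈_ to from → StrictlyInverseʳ S._≈_ to from → Inverse S T
  mkInverseₛ to from to-cong from-cong invˡ invʳ = record
    { to        = to
    ; from      = from
    ; to-cong   = to-cong
    ; from-cong = from-cong
    ; inverse   = strictlyInverseˡ⇒inverseˡ to-cong invˡ , strictlyInverseʳ⇒inverseʳ from-cong invʳ
    }
    where open Consequences S T

module _ {a ℓ} (A : Setoid a ℓ) where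
  open Setoid A
  open VecEq A using (≋-setoid)

  vector-inverse-^ : ∀ {u} → Inverse A (≡.setoid (Fin u)) → ∀ N → Inverse (≋-setoid N) (≡.setoid (Fin (u ^ N)))
  vector-inverse-^ A↔u zero =
    mkInverseₛ (λ _ → zero) (λ _ ()) (λ _ → ≡.refl) (λ _ ()) (λ { zero → ≡.refl }) (λ _ ())
  vector-inverse-^ {u} A↔u (suc N) = mkInverseₛ to from
    (λ v≋w → ≡.cong₂ combine (I.to-cong (v≋w zero)) (IH.to-cong (λ q → v≋w (suc q))))
    (λ { ≡.refl q → refl })
    (λ k → ≡.trans (≡.cong₂ combine (I.strictlyInverseˡ _) (IH.strictlyInverseˡ _)) (combine-remQuot {u} (u ^ N) k))
    from-to
    where
    module I  = Inverse A↔u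
    module IH = Inverse (vector-inverse-^ A↔u N)

    to : Vector Carrier (suc N) → Fin (u ^ suc N)
    to v = combine (I.to (head v)) (IH.to (tail v))

    from : Fin (u ^ suc N) → Vector Carrier (suc N)
    from k = I.from (proj₁ (remQuot {u} (u ^ N) k)) ∷ IH.from (proj₂ (remQuot {u} (u ^ N) k))

    from-to : ∀ v q → from (to v) q ≈ v q
    from-to v q = trans
      (reflexive (≡.cong (λ p → (I.from (proj₁ p) ∷ IH.from (proj₂ p)) q) (remQuot-combine {u} (I.to (head v)) (IH.to (tail v)))))
      (componentwise q)
      where
      componentwise : ∀ q → (I.from (I.to (head v)) ∷ IH.from (IH.to (tail v))) q ≈ v q
      componentwise zero    = I.strictlyInverseʳ (head v)
      componentwise (suc q) = IH.strictlyInverseʳ (tail v) q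

module RowMajorIndex where
  open import Data.Nat
  open import Data.Nat.Properties
  open import Data.Nat.DivMod using (_/_; _%_; m≡m%n+[m/n]*n; [m+kn]%n≡m%n; m<n⇒m%n≡m)
  open ≡ using (cong; trans)
  open ≤-Reasoning

  row-major-mono-≤ : ∀ m {i i′ j j′} → i ≤ i′ → j ≤ j′ → m * i + j ≤ m * i′ + j′
  row-major-mono-≤ m i≤i′ j≤j′ = +-mono-≤ (*-monoʳ-≤ m i≤i′) j≤j′

  row-major-<-row : ∀ {m i i′ j} j′ → i < i′ → j < m → m * i + j < m * i′ + j′
  row-major-<-row {m} {i} {i′} {j} j′ i<i′ j<m = begin-strict
    m * i + j    <⟨ +-monoʳ-< (m * i) j<m ⟩
    m * i + m    ≡⟨ +-comm (m * i) m ⟩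
    m + m * i    ≡⟨ *-suc m i ⟨
    m * suc i    ≤⟨ *-monoʳ-≤ m i<i′ ⟩
    m * i′       ≤⟨ m≤m+n (m * i′) j′ ⟩
    m * i′ + j′  ∎

  row-major-<-* : ∀ {m n i j} → i < n → j < m → m * i + j < n * m
  row-major-<-* {m} {n} {i} {j} i<n j<m = begin-strict
    m * i + j  <⟨ row-major-<-row 0 i<n j<m ⟩
    m * n + 0  ≡⟨ +-identityʳ (m * n) ⟩
    m * n      ≡⟨ *-comm m n ⟩
    n * m      ∎

  row-major-<-*⁻¹ : ∀ {m n} i j → m * i + j < n * m → i < n
  row-major-<-*⁻¹ {m} {n} i j lt = *-cancelˡ-< m i n (begin-strict
    m * i      ≤⟨ m≤m+n (m * i) j ⟩
    m * i + j  <⟨ lt ⟩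
    n * m      ≡⟨ *-comm n m ⟩
    m * n      ∎)

  row-major-/%-inverse : ∀ t m .{{_ : NonZero m}} → m * (t / m) + t % m ≡ t
  row-major-/%-inverse t m = begin-equality
    m * (t / m) + t % m  ≡⟨ +-comm (m * (t / m)) (t % m) ⟩
    t % m + m * (t / m)  ≡⟨ cong (t % m +_) (*-comm m (t / m)) ⟩
    t % m + t / m * m    ≡⟨ m≡m%n+[m/n]*n t m ⟨
    t                    ∎

  row-major-% : ∀ {m j} i .{{_ : NonZero m}} → j < m → (m * i + j) % m ≡ j
  row-major-% {m} {j} i j<m = begin-equality
    (m * i + j) % m  ≡⟨ cong (_% m) (trans (+-comm (m * i) j) (cong (j +_) (*-comm m i))) ⟩
    (j + i * m) % m  ≡⟨ [m+kn]%n≡m%n j i m ⟩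
    j % m            ≡⟨ m<n⇒m%n≡m j<m ⟩
    j                ∎

  row-major-/ : ∀ {m j} i .{{_ : NonZero m}} → j < m → (m * i + j) / m ≡ i
  row-major-/ {m} {j} i j<m = *-cancelˡ-≡ _ i m (+-cancelʳ-≡ j _ (m * i) (begin-equality
    m * ((m * i + j) / m) + j                ≡⟨ cong (m * ((m * i + j) / m) +_) (row-major-% i j<m) ⟨
    m * ((m * i + j) / m) + (m * i + j) % m  ≡⟨ row-major-/%-inverse (m * i + j) m ⟩
    m * i + j                                ∎))

open RowMajorIndex

punchIn-fromℕ : ∀ {k} (a : Fin k) → punchIn (fromℕ k) a ≡ inject₁ a
punchIn-fromℕ zero    = ≡.refl
punchIn-fromℕ (suc a) = ≡.cong suc (punchIn-fromℕ a)

punchIn-inject₁ : ∀ {k} (i : Fin (suc k)) (a : Fin k) → punchIn (inject₁ i) (inject₁ a) ≡ inject₁ (punchIn i a)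
punchIn-inject₁ zero    a       = ≡.refl
punchIn-inject₁ (suc i) zero    = ≡.refl
punchIn-inject₁ (suc i) (suc a) = ≡.cong suc (punchIn-inject₁ i a)

punchIn-inject₁-fromℕ : ∀ {k} (i : Fin (suc k)) → punchIn (inject₁ i) (fromℕ k) ≡ fromℕ (suc k)
punchIn-inject₁-fromℕ         zero    = ≡.refl
punchIn-inject₁-fromℕ {suc k} (suc i) = ≡.cong suc (punchIn-inject₁-fromℕ i)

module UnitProperties {c ℓ} (R : CommutativeRing c ℓ) where
  open CommutativeRing R
  open import Algebra.Properties.Group +-group using (//-rightDividesˡ)
  open import Relation.Binary.Reasoning.Setoid setoid

  IsUnit-resp : ∀ {x y} → x ≈ y → IsUnit R x → IsUnit R y
  IsUnit-resp x≈y (x⁻¹ , xx⁻¹≈1) = x⁻¹ , trans (*-congʳ (sym x≈y)) xx⁻¹≈1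

  *-cancel-unit : ∀ {x x⁻¹} y → x * x⁻¹ ≈ 1# → x * (y * x⁻¹) ≈ y
  *-cancel-unit {x} {x⁻¹} y xx⁻¹≈1 = begin
    x * (y * x⁻¹)  ≈⟨ *-congˡ (*-comm y x⁻¹) ⟩
    x * (x⁻¹ * y)  ≈⟨ *-assoc x x⁻¹ y ⟨
    (x * x⁻¹) * y  ≈⟨ *-congʳ xx⁻¹≈1 ⟩
    1# * y         ≈⟨ *-identityˡ y ⟩
    y              ∎

  inverse-unique : ∀ {x y x⁻¹ y⁻¹} → x ≈ y → x * x⁻¹ ≈ 1# → y * y⁻¹ ≈ 1# → x⁻¹ ≈ y⁻¹
  inverse-unique {x} {y} {x⁻¹} {y⁻¹} x≈y xx⁻¹≈1 yy⁻¹≈1 = begin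
    x⁻¹              ≈⟨ *-cancel-unit x⁻¹ yy⁻¹≈1 ⟨
    y * (x⁻¹ * y⁻¹)  ≈⟨ *-congˡ (*-comm x⁻¹ y⁻¹) ⟩
    y * (y⁻¹ * x⁻¹)  ≈⟨ *-congʳ x≈y ⟨
    x * (y⁻¹ * x⁻¹)  ≈⟨ *-cancel-unit y⁻¹ xx⁻¹≈1 ⟩
    y⁻¹              ∎

  affine-solve : ∀ {x x⁻¹} y r → x * x⁻¹ ≈ 1# → x * ((y - r) * x⁻¹) + r ≈ y
  affine-solve y r xx⁻¹≈1 = trans (+-congʳ (*-cancel-unit (y - r) xx⁻¹≈1)) (//-rightDividesˡ r y)

module Determinant {c ℓ} (R : CommutativeRing c ℓ) where
  open CommutativeRing R hiding (zero)
  open import Algebra.Properties.Semiring.Sum semiring using (sum; sum-cong-≋; sum-init-last; ∑-distrib-+; *-distribˡ-sum)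
  open import Algebra.Solver.Ring.NaturalCoefficients.Default commutativeSemiring
  open import Relation.Binary.Reasoning.Setoid setoid

  minor : ∀ {k} → Matrix R (suc k) (suc k) → Fin (suc k) → Matrix R k k
  minor A i a b = A (punchIn i a) (suc b)

  leading : ∀ {k} → Matrix R (suc k) (suc k) → Matrix R k k
  leading A a b = A (inject₁ a) (inject₁ b)

  laplaceTerm : ∀ {k} → Matrix R (suc k) (suc k) → Fin (suc k) → Carrier
  laplaceTerm A i = sign R i * (A i zero * det R (minor A i))

  ∑≡sum : ∀ {k} (f : Fin k → Carrier) → ∑ R f ≡ sum f
  ∑≡sum {zero}  f = ≡.refl
  ∑≡sum {suc k} f = ≡.cong (f zero +_) (∑≡sum (λ i → f (suc i)))

  det-laplace : ∀ {k} (A : Matrix R (suc k) (suc k)) → det R A ≡ sum (laplaceTerm A)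
  det-laplace A = ∑≡sum (laplaceTerm A)

  det-cong : ∀ {k} {A B : Matrix R k k} → (∀ a b → A a b ≈ B a b) → det R A ≈ det R B
  det-cong {zero}  A≈B = refl
  det-cong {suc k} {A} {B} A≈B = begin
    det R A              ≡⟨ det-laplace A ⟩
    sum (laplaceTerm A)  ≈⟨ sum-cong-≋ terms≈ ⟩
    sum (laplaceTerm B)  ≡⟨ det-laplace B ⟨
    det R B              ∎
    where
    terms≈ : ∀ i → laplaceTerm A i ≈ laplaceTerm B i
    terms≈ i = *-congˡ (*-cong (A≈B i zero) (det-cong λ a b → A≈B (punchIn i a) (suc b)))

  sign-inject₁ : ∀ {k} (i : Fin k) → sign R (inject₁ i) ≡ sign R i
  sign-inject₁ zero    = ≡.refl
  sign-inject₁ (suc i) = ≡.cong -_ (sign-inject₁ i)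

  sum-init-last-+-* : ∀ {k} (f : Fin (suc k) → Carrier) (x : Carrier) (g : Fin k → Carrier) →
    sum f + x * sum g ≈ sum (λ i → f (inject₁ i) + x * g i) + f (fromℕ k)
  sum-init-last-+-* {k} f x g = begin
    sum f + x * sum g                                      ≈⟨ +-cong (sum-init-last f) (*-distribˡ-sum x g) ⟩
    (sum f′ + f (fromℕ k)) + sum (λ i → x * g i)          ≈⟨ swap _ _ _ ⟩
    (sum f′ + sum (λ i → x * g i)) + f (fromℕ k)          ≈⟨ +-congʳ (∑-distrib-+ f′ (λ i → x * g i)) ⟨
    sum (λ i → f (inject₁ i) + x * g i) + f (fromℕ k)     ∎
    where
    f′ = λ i → f (inject₁ i)
    swap : ∀ p q r → (p + q) + r ≈ (p + r) + q
    swap = solve 3 (λ p q r → (p :+ q) :+ r := (p :+ r) :+ q) refl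

  OffCornerEqual : ∀ {k} → Matrix R (suc k) (suc k) → Matrix R (suc k) (suc k) → Set ℓ
  OffCornerEqual {k} A B =
    (∀ a b → A (inject₁ a) b ≈ B (inject₁ a) b) × (∀ b → A (fromℕ k) (inject₁ b) ≈ B (fromℕ k) (inject₁ b))

  minor-last-cong : ∀ {k} (A B : Matrix R (suc k) (suc k)) → OffCornerEqual A B →
    ∀ a b → minor A (fromℕ k) a b ≈ minor B (fromℕ k) a b
  minor-last-cong A B (rows≈ , _) a b = begin
    A (punchIn (fromℕ _) a) (suc b)  ≡⟨ ≡.cong (λ r → A r (suc b)) (punchIn-fromℕ a) ⟩
    A (inject₁ a) (suc b)            ≈⟨ rows≈ a (suc b) ⟩
    B (inject₁ a) (suc b)            ≡⟨ ≡.cong (λ r → B r (suc b)) (punchIn-fromℕ a) ⟨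
    B (punchIn (fromℕ _) a) (suc b)  ∎

  minor-offCornerEqual : ∀ {k} (A B : Matrix R (suc (suc k)) (suc (suc k))) → OffCornerEqual A B →
    ∀ i → OffCornerEqual (minor A (inject₁ i)) (minor B (inject₁ i))
  minor-offCornerEqual {k} A B (rows≈ , last≈) i = rows′ , last′
    where
    rows′ : ∀ a b → A (punchIn (inject₁ i) (inject₁ a)) (suc b) ≈ B (punchIn (inject₁ i) (inject₁ a)) (suc b)
    rows′ a b = begin
      A (punchIn (inject₁ i) (inject₁ a)) (suc b)  ≡⟨ ≡.cong (λ r → A r (suc b)) (punchIn-inject₁ i a) ⟩
      A (inject₁ (punchIn i a)) (suc b)            ≈⟨ rows≈ (punchIn i a) (suc b) ⟩
      B (inject₁ (punchIn i a)) (suc b)            ≡⟨ ≡.cong (λ r → B r (suc b)) (punchIn-inject₁ i a) ⟨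
      B (punchIn (inject₁ i) (inject₁ a)) (suc b)  ∎
    last′ : ∀ b → A (punchIn (inject₁ i) (fromℕ k)) (suc (inject₁ b))
                ≈ B (punchIn (inject₁ i) (fromℕ k)) (suc (inject₁ b))
    last′ b = begin
      A (punchIn (inject₁ i) (fromℕ k)) (suc (inject₁ b))  ≡⟨ ≡.cong (λ r → A r (suc (inject₁ b))) (punchIn-inject₁-fromℕ i) ⟩
      A (fromℕ (suc k)) (suc (inject₁ b))                  ≈⟨ last≈ (suc b) ⟩
      B (fromℕ (suc k)) (suc (inject₁ b))                  ≡⟨ ≡.cong (λ r → B r (suc (inject₁ b))) (punchIn-inject₁-fromℕ i) ⟨
      B (punchIn (inject₁ i) (fromℕ k)) (suc (inject₁ b))  ∎

  minor-corner : ∀ {k} (A : Matrix R (suc (suc k)) (suc (suc k))) i →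
    minor A (inject₁ i) (fromℕ k) (fromℕ k) ≡ A (fromℕ (suc k)) (fromℕ (suc k))
  minor-corner A i = ≡.cong (λ r → A r _) (punchIn-inject₁-fromℕ i)

  det-leading-minor : ∀ {k} (A : Matrix R (suc (suc k)) (suc (suc k))) i →
    det R (leading (minor A (inject₁ i))) ≈ det R (minor (leading A) i)
  det-leading-minor A i = det-cong λ a b → reflexive (≡.cong (λ r → A r (suc (inject₁ b))) (punchIn-inject₁ i a))

  det-affine-in-corner : ∀ {k} (A B : Matrix R (suc k) (suc k)) → OffCornerEqual A B →
    det R A + B (fromℕ k) (fromℕ k) * det R (leading A) ≈ det R B + A (fromℕ k) (fromℕ k) * det R (leading A)
  det-affine-in-corner {zero} A B _ =
    solve 2 (λ a b → (con 1 :* (a :* con 1) :+ con 0) :+ b :* con 1 := (con 1 :* (b :* con 1) :+ con 0) :+ a :* con 1)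
      refl (A zero zero) (B zero zero)
  det-affine-in-corner {suc k} A B A≈B = begin
    det R A + b * det R (leading A)
      ≡⟨ ≡.cong₂ (λ p q → p + b * q) (det-laplace A) (det-laplace (leading A)) ⟩
    sum (laplaceTerm A) + b * sum h
      ≈⟨ sum-init-last-+-* (laplaceTerm A) b h ⟩
    sum (λ i → laplaceTerm A (inject₁ i) + b * h i) + laplaceTerm A last
      ≈⟨ +-cong (sum-cong-≋ inner) last-term ⟩
    sum (λ i → laplaceTerm B (inject₁ i) + a * h i) + laplaceTerm B last
      ≈⟨ sum-init-last-+-* (laplaceTerm B) a h ⟨
    sum (laplaceTerm B) + a * sum h
      ≡⟨ ≡.cong₂ (λ p q → p + a * q) (det-laplace B) (det-laplace (leading A)) ⟨
    det R B + a * det R (leading A)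
      ∎
    where
    last = fromℕ (suc k)
    a = A last last
    b = B last last
    h = laplaceTerm (leading A)

    last-term : laplaceTerm A last ≈ laplaceTerm B last
    last-term = *-congˡ (*-cong (proj₂ A≈B zero) (det-cong (minor-last-cong A B A≈B)))

    inner : ∀ i → laplaceTerm A (inject₁ i) + b * h i ≈ laplaceTerm B (inject₁ i) + a * h i
    inner i = begin
      sign R (inject₁ i) * (x * dA) + b * (s * (x * d))
        ≡⟨ ≡.cong (λ t → t * (x * dA) + b * (s * (x * d))) (sign-inject₁ i) ⟩
      s * (x * dA) + b * (s * (x * d))
        ≈⟨ factor dA b ⟩
      (s * x) * (dA + b * d)
        ≈⟨ *-congˡ minors ⟩
      (s * x) * (dB + a * d)
        ≈⟨ factor dB a ⟨
      s * (x * dB) + a * (s * (x * d))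
        ≈⟨ +-congʳ (*-cong (reflexive (≡.sym (sign-inject₁ i))) (*-congʳ (proj₁ A≈B i zero))) ⟩
      sign R (inject₁ i) * (B (inject₁ i) zero * dB) + a * (s * (x * d))
        ∎
      where
      s = sign R i
      x = A (inject₁ i) zero
      mA = minor A (inject₁ i)
      mB = minor B (inject₁ i)
      dA = det R mA
      dB = det R mB
      d = det R (minor (leading A) i)

      factor : ∀ e f → s * (x * e) + f * (s * (x * d)) ≈ (s * x) * (e + f * d)
      factor = solve 5 (λ s x d e f → s :* (x :* e) :+ f :* (s :* (x :* d)) := (s :* x) :* (e :+ f :* d)) refl s x d

      minors : dA + b * d ≈ dB + a * d
      minors = begin
        dA + b * d
          ≈⟨ +-congˡ (*-cong (reflexive (minor-corner B i)) (det-leading-minor A i)) ⟨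
        dA + mB (fromℕ k) (fromℕ k) * det R (leading mA)
          ≈⟨ det-affine-in-corner mA mB (minor-offCornerEqual A B A≈B i) ⟩
        dB + mA (fromℕ k) (fromℕ k) * det R (leading mA)
          ≈⟨ +-congˡ (*-cong (reflexive (minor-corner A i)) (det-leading-minor A i)) ⟩
        dB + a * d
          ∎

module TriangularSystem {c ℓ} (R : CommutativeRing c ℓ) where
  open CommutativeRing R hiding (zero)
  open UnitProperties R
  open VecEq setoid using (_≋_) renaming (≋-setoid to vectors)
  open VecEq (Units R) using () renaming (≋-setoid to unitVectors)
  open import Algebra.Properties.Group +-group using (//-cong₂; //-rightDividesʳ)
  open import Relation.Binary.Reasoning.Setoid setoid

  record Step (N : ℕ) : Set (c ⊔ ℓ) where
    field
      coeff rest : Vector Carrier N → Carrier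
      coeff-cong : ∀ {w w′} → w ≋ w′ → coeff w ≈ coeff w′
      rest-cong  : ∀ {w w′} → w ≋ w′ → rest w ≈ rest w′
  open Step public

  System : ℕ → Set (c ⊔ ℓ)
  System zero    = Lift (c ⊔ ℓ) ⊤
  System (suc N) = System N × Step N

  eval : ∀ {N} → System N → Vector Carrier N → Vector Carrier N
  eval (S , st) v zero    = coeff st (tail v) * head v + rest st (tail v)
  eval (S , st) v (suc q) = eval S (tail v) q

  eval-cong : ∀ {N} (S : System N) {v w} → v ≋ w → eval S v ≋ eval S w
  eval-cong (S , st) v≋w zero    = +-cong (*-cong (coeff-cong st (λ q → v≋w (suc q))) (v≋w zero))
                                          (rest-cong st (λ q → v≋w (suc q)))
  eval-cong (S , st) v≋w (suc q) = eval-cong S (λ q → v≋w (suc q)) q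

  Admissible : ∀ {N} → System N → Vector Carrier N → Set (c ⊔ ℓ)
  Admissible S v = ∀ q → IsUnit R (eval S v q)

  admissibles : ∀ {N} → System N → Setoid (c ⊔ ℓ) ℓ
  admissibles {N} S = On.setoid (vectors N) (proj₁ {B = Admissible S})

  Regular : ∀ {N} → System N → Set (c ⊔ ℓ)
  Regular {zero}  _        = Lift (c ⊔ ℓ) ⊤
  Regular {suc N} (S , st) = Regular S × (∀ w → Admissible S w → IsUnit R (coeff st w))

  evalUnits : ∀ {N} (S : System N) → Σ (Vector Carrier N) (Admissible S) → Vector (Σ Carrier (IsUnit R)) N
  evalUnits S (v , av) q = eval S v q , av q

  solution : ∀ {N} (S : System N) → Regular S → Vector (Σ Carrier (IsUnit R)) N → Vector Carrier N
  solution-admissible : ∀ {N} (S : System N) (reg : Regular S) x → Admissible S (solution S reg x)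
  eval-solution : ∀ {N} (S : System N) (reg : Regular S) x q → eval S (solution S reg x) q ≈ proj₁ (x q)

  coeff-unit : ∀ {N} (S : System N) (st : Step N) (reg : Regular (S , st)) x →
    IsUnit R (coeff st (solution S (proj₁ reg) (tail x)))
  coeff-unit S st (reg , coeff-units) x = coeff-units _ (solution-admissible S reg (tail x))

  solution {zero}  _        _   _ ()
  solution {suc N} (S , st) reg x =
    (proj₁ (head x) - rest st (solution S (proj₁ reg) (tail x))) * proj₁ (coeff-unit S st reg x)
    ∷ solution S (proj₁ reg) (tail x)

  eval-solution (S , st) reg x zero    = affine-solve _ _ (proj₂ (coeff-unit S st reg x))
  eval-solution (S , st) reg x (suc q) = eval-solution S (proj₁ reg) (tail x) q

  solution-admissible S reg x q = IsUnit-resp (sym (eval-solution S reg x q)) (proj₂ (x q))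

  solution-cong : ∀ {N} (S : System N) (reg : Regular S) {x y} → (∀ q → proj₁ (x q) ≈ proj₁ (y q)) →
    solution S reg x ≋ solution S reg y
  solution-cong (S , st) reg {x} {y} x≈y zero =
    *-cong (+-cong (x≈y zero) (-‿cong (rest-cong st tails≋)))
           (inverse-unique (coeff-cong st tails≋) (proj₂ (coeff-unit S st reg x)) (proj₂ (coeff-unit S st reg y)))
    where tails≋ = solution-cong S (proj₁ reg) (λ q → x≈y (suc q))
  solution-cong (S , st) reg x≈y (suc q) = solution-cong S (proj₁ reg) (λ q → x≈y (suc q)) q

  solution-eval : ∀ {N} (S : System N) (reg : Regular S) (v : Σ (Vector Carrier N) (Admissible S)) →
    solution S reg (evalUnits S v) ≋ proj₁ v
  solution-eval (S , st) reg (v , av) zero = begin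
    ((coeff st (tail v) * head v + rest st (tail v)) - rest st w) * c⁻¹
      ≈⟨ *-congʳ (//-cong₂ (+-cong (*-congʳ (coeff-cong st w≋tail)) (rest-cong st w≋tail)) refl) ⟨
    ((coeff st w * head v + rest st w) - rest st w) * c⁻¹
      ≈⟨ *-congʳ (//-rightDividesʳ (rest st w) (coeff st w * head v)) ⟩
    (coeff st w * head v) * c⁻¹
      ≈⟨ *-assoc _ _ _ ⟩
    coeff st w * (head v * c⁻¹)
      ≈⟨ *-cancel-unit (head v) (proj₂ (coeff-unit S st reg (evalUnits (S , st) (v , av)))) ⟩
    head v ∎
    where
    w = solution S (proj₁ reg) (evalUnits S (tail v , λ q → av (suc q)))
    w≋tail = solution-eval S (proj₁ reg) (tail v , λ q → av (suc q))
    c⁻¹ = proj₁ (coeff-unit S st reg (evalUnits (S , st) (v , av)))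
  solution-eval (S , st) reg (v , av) (suc q) = solution-eval S (proj₁ reg) (tail v , λ q → av (suc q)) q

  eval-inverse : ∀ {N} (S : System N) → Regular S → Inverse (admissibles S) (unitVectors N)
  eval-inverse S reg = mkInverseₛ (evalUnits S) (λ x → solution S reg x , solution-admissible S reg x)
    (eval-cong S) (solution-cong S reg) (eval-solution S reg) (solution-eval S reg)

module BorderSquares {c ℓ} (R : CommutativeRing c ℓ) where
  open CommutativeRing R hiding (zero)
  open UnitProperties R using (IsUnit-resp)
  open Determinant R
  open import Relation.Binary.Reasoning.Setoid setoid

  square : (ℕ → ℕ → Carrier) → (x y k : ℕ) → Matrix R k k
  square g x y k a b = g (x ℕ.+ toℕ a) (y ℕ.+ toℕ b)

  -- The largest square on the upper or left border whose bottom-right entry is (i, j).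
  borderSquare : (ℕ → ℕ → Carrier) → (i j : ℕ) → Matrix R (suc (i ⊓ j)) (suc (i ⊓ j))
  borderSquare g i j = square g (i ∸ i ⊓ j) (j ∸ i ⊓ j) (suc (i ⊓ j))

  borderMinor : (ℕ → ℕ → Carrier) → (i j : ℕ) → Matrix R (i ⊓ j) (i ⊓ j)
  borderMinor g i j = square g (i ∸ i ⊓ j) (j ∸ i ⊓ j) (i ⊓ j)

  det-borderSquare-upper : ∀ g {i j} → i ≤ j → det R (borderSquare g i j) ≡ det R (square g 0 (j ∸ i) (suc i))
  det-borderSquare-upper g {i} i≤j rewrite m≤n⇒m⊓n≡m i≤j | n∸n≡0 i = ≡.refl

  det-borderSquare-left : ∀ g {i j} → j ≤ i → det R (borderSquare g i j) ≡ det R (square g (i ∸ j) 0 (suc j))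
  det-borderSquare-left g {i} {j} j≤i rewrite m≥n⇒m⊓n≡n j≤i | n∸n≡0 j = ≡.refl

  module _ {n m} (M : Matrix R n m) (g : ℕ → ℕ → Carrier) (g≈M : ∀ I J → g (toℕ I) (toℕ J) ≈ M I J) where

    upperSub≈square : ∀ k j k≤n j+k≤m a b → upperSub R M k j k≤n j+k≤m a b ≈ square g 0 j k a b
    upperSub≈square k j k≤n j+k≤m a b = sym (trans
      (reflexive (≡.cong₂ g (≡.sym (toℕ-inject≤ a k≤n)) (≡.sym (≡.trans (toℕ-inject≤ (j ↑ʳ b) j+k≤m) (toℕ-↑ʳ j b)))))
      (g≈M _ _))

    leftSub≈square : ∀ k i i+k≤n k≤m a b → leftSub R M k i i+k≤n k≤m a b ≈ square g i 0 k a b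
    leftSub≈square k i i+k≤n k≤m a b = sym (trans
      (reflexive (≡.cong₂ g (≡.sym (≡.trans (toℕ-inject≤ (i ↑ʳ a) i+k≤n) (toℕ-↑ʳ i a))) (≡.sym (toℕ-inject≤ b k≤m))))
      (g≈M _ _))

    pascalLike⇒borderSquares : PascalLike R M → ∀ i j → i < n → j < m → IsUnit R (det R (borderSquare g i j))
    pascalLike⇒borderSquares (upper , left) i j i<n j<m with ≤-total i j
    ... | inj₁ i≤j = IsUnit-resp
      (trans (det-cong (upperSub≈square (suc i) (j ∸ i) i<n fits)) (reflexive (≡.sym (det-borderSquare-upper g i≤j))))
      (upper (suc i) (j ∸ i) (s≤s z≤n) i<n fits)
      where
      fits : j ∸ i ℕ.+ suc i ≤ m
      fits = ≡.subst (_≤ m) (≡.sym (≡.trans (+-suc (j ∸ i) i) (≡.cong suc (m∸n+n≡m i≤j)))) j<m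
    ... | inj₂ j≤i = IsUnit-resp
      (trans (det-cong (leftSub≈square (suc j) (i ∸ j) fits j<m)) (reflexive (≡.sym (det-borderSquare-left g j≤i))))
      (left (suc j) (i ∸ j) (s≤s z≤n) fits j<m)
      where
      fits : i ∸ j ℕ.+ suc j ≤ n
      fits = ≡.subst (_≤ n) (≡.sym (≡.trans (+-suc (i ∸ j) j) (≡.cong suc (m∸n+n≡m j≤i)))) i<n

    borderSquares⇒pascalLike : (∀ i j → i < n → j < m → IsUnit R (det R (borderSquare g i j))) → PascalLike R M
    borderSquares⇒pascalLike units = upper , left
      where
      upper : ∀ k j → 1 ≤ k → (k≤n : k ≤ n) (j+k≤m : j ℕ.+ k ≤ m) → IsUnit R (det R (upperSub R M k j k≤n j+k≤m))
      upper (suc k) j _ k≤n j+k≤m = IsUnit-resp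
        (trans (reflexive (≡.trans (det-borderSquare-upper g (m≤n+m k j)) (≡.cong (λ y → det R (square g 0 y (suc k))) (m+n∸n≡m j k))))
               (sym (det-cong (upperSub≈square (suc k) j k≤n j+k≤m))))
        (units k (j ℕ.+ k) k≤n (≡.subst (_≤ m) (+-suc j k) j+k≤m))
      left : ∀ k i → 1 ≤ k → (i+k≤n : i ℕ.+ k ≤ n) (k≤m : k ≤ m) → IsUnit R (det R (leftSub R M k i i+k≤n k≤m))
      left (suc k) i _ i+k≤n k≤m = IsUnit-resp
        (trans (reflexive (≡.trans (det-borderSquare-left g (m≤n+m k i)) (≡.cong (λ x → det R (square g x 0 (suc k))) (m+n∸n≡m i k))))
               (sym (det-cong (leftSub≈square (suc k) i i+k≤n k≤m))))
        (units (i ℕ.+ k) k (≡.subst (_≤ n) (+-suc i k) i+k≤n) k≤m)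

  module _ (i j : ℕ) where
    private
      s = i ⊓ j
      x = i ∸ s
      y = j ∸ s

      x+s≡i : x ℕ.+ s ≡ i
      x+s≡i = m∸n+n≡m (m⊓n≤m i j)

      y+s≡j : y ℕ.+ s ≡ j
      y+s≡j = m∸n+n≡m (m⊓n≤n i j)

      inside : ∀ {z l} → z ℕ.+ s ≡ l → (a : Fin (suc s)) → z ℕ.+ toℕ a ≤ l
      inside {z} e a = ≡.subst (z ℕ.+ toℕ a ≤_) e (+-monoʳ-≤ z (toℕ≤pred[n] a))

      below : ∀ {z l} → z ℕ.+ s ≡ l → (a : Fin s) → z ℕ.+ toℕ (inject₁ a) < l
      below {z} e a = ≡.subst (z ℕ.+ toℕ (inject₁ a) <_) e (+-monoʳ-< z (inject₁ℕ< a))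

      at-corner : ∀ {z l} → z ℕ.+ s ≡ l → z ℕ.+ toℕ (fromℕ s) ≡ l
      at-corner {z} e = ≡.trans (≡.cong (z ℕ.+_) (toℕ-fromℕ s)) e

    borderSquare-local : ∀ {g h} → (∀ r c → r ≤ i → c ≤ j → g r c ≈ h r c) →
      det R (borderSquare g i j) ≈ det R (borderSquare h i j)
    borderSquare-local g≈h = det-cong λ a b → g≈h _ _ (inside x+s≡i a) (inside y+s≡j b)

    borderSquare-expand : ∀ {g h} → (∀ r c → r < i → c ≤ j → g r c ≈ h r c) → (∀ c → c < j → g i c ≈ h i c) →
      h i j ≈ 0# → det R (borderSquare g i j) ≈ det R (borderMinor h i j) * g i j + det R (borderSquare h i j)
    borderSquare-expand {g} {h} rows≈ last≈ hij≈0 = begin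
      det R A                                      ≈⟨ +-identityʳ (det R A) ⟨
      det R A + 0#                                 ≈⟨ +-congˡ (zeroˡ (det R (leading A))) ⟨
      det R A + 0# * det R (leading A)             ≈⟨ +-congˡ (*-congʳ (trans (reflexive (corner h)) hij≈0)) ⟨
      det R A + B l l * det R (leading A)          ≈⟨ det-affine-in-corner A B (rows , last) ⟩
      det R B + A l l * det R (leading A)          ≈⟨ +-comm _ _ ⟩
      A l l * det R (leading A) + det R B          ≈⟨ +-congʳ (*-comm _ _) ⟩
      det R (leading A) * A l l + det R B          ≈⟨ +-congʳ (*-cong (det-cong leading≈) (reflexive (corner g))) ⟩
      det R (borderMinor h i j) * g i j + det R B  ∎
      where
      A = borderSquare g i j
      B = borderSquare h i j
      l = fromℕ s

      corner : ∀ f → borderSquare f i j l l ≡ f i j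
      corner f = ≡.cong₂ f (at-corner x+s≡i) (at-corner y+s≡j)

      rows : ∀ a b → A (inject₁ a) b ≈ B (inject₁ a) b
      rows a b = rows≈ _ _ (below x+s≡i a) (inside y+s≡j b)

      last : ∀ b → A l (inject₁ b) ≈ B l (inject₁ b)
      last b = trans (reflexive (≡.cong (λ r → g r column) (at-corner x+s≡i)))
        (trans (last≈ _ (below y+s≡j b)) (reflexive (≡.cong (λ r → h r column) (≡.sym (at-corner x+s≡i)))))
        where column = y ℕ.+ toℕ (inject₁ b)

      leading≈ : ∀ a b → leading A a b ≈ borderMinor h i j a b
      leading≈ a b = trans (rows a (inject₁ b))
        (reflexive (≡.cong₂ (λ p q → h (x ℕ.+ p) (y ℕ.+ q)) (toℕ-inject₁ a) (toℕ-inject₁ b)))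

module RowMajor {c ℓ} (R : CommutativeRing c ℓ) (m : ℕ) .{{_ : NonZero m}} where
  open CommutativeRing R hiding (zero)
  open VecEq setoid using (_≋_)
  open UnitProperties R using (IsUnit-resp)
  open Determinant R using (det-cong)
  open TriangularSystem R
  open BorderSquares R

  -- A vector w of length N holds the entries 0, …, N - 1 of a matrix with m columns in row-major
  -- order, listed backwards (head w is entry N - 1); entry w t reads entry t, and is 0# for t ≥ N.
  entry : ∀ {N} → Vector Carrier N → ℕ → Carrier
  entry {zero}  w t = 0#
  entry {suc N} w t with t ≟ N
  ... | yes _ = head w
  ... | no  _ = entry (tail w) t

  grid : ∀ {N} → Vector Carrier N → ℕ → ℕ → Carrier
  grid w r c = entry w (m ℕ.* r ℕ.+ c)

  entry-head : ∀ {N} (w : Vector Carrier (suc N)) → entry w N ≡ head w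
  entry-head {N} w with N ≟ N
  ... | yes _   = ≡.refl
  ... | no  N≢N = contradiction ≡.refl N≢N

  entry-tail : ∀ {N t} (w : Vector Carrier (suc N)) → t < N → entry w t ≡ entry (tail w) t
  entry-tail {N} {t} w t<N with t ≟ N
  ... | yes ≡.refl = contradiction t<N (<-irrefl ≡.refl)
  ... | no  _      = ≡.refl

  entry-beyond : ∀ {N t} (w : Vector Carrier N) → N ≤ t → entry w t ≡ 0#
  entry-beyond {zero}      w _   = ≡.refl
  entry-beyond {suc N} {t} w N<t with t ≟ N
  ... | yes ≡.refl = contradiction N<t (<-irrefl ≡.refl)
  ... | no  _      = entry-beyond (tail w) (<⇒≤ N<t)

  entry-opposite : ∀ {N} (w : Vector Carrier N) q → entry w (toℕ (opposite q)) ≡ w q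
  entry-opposite {suc N} w zero    rewrite toℕ-fromℕ N = entry-head w
  entry-opposite {suc N} w (suc q) rewrite opposite-suc q =
    ≡.trans (entry-tail w (toℕ<n (opposite q))) (entry-opposite (tail w) q)

  entry-cong : ∀ {N} {w w′ : Vector Carrier N} → w ≋ w′ → ∀ t → entry w t ≈ entry w′ t
  entry-cong {zero}  w≋w′ t = refl
  entry-cong {suc N} w≋w′ t with t ≟ N
  ... | yes _ = w≋w′ zero
  ... | no  _ = entry-cong (λ q → w≋w′ (suc q)) t

  grid-tail : ∀ {N} (v : Vector Carrier (suc N)) r c → m ℕ.* r ℕ.+ c < N → grid v r c ≈ grid (tail v) r c
  grid-tail v r c lt = reflexive (entry-tail v lt)

  step : ∀ N → Step N
  step N = record
    { coeff      = λ w → det R (borderMinor (grid w) (N / m) (N % m))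
    ; rest       = λ w → det R (borderSquare (grid w) (N / m) (N % m))
    ; coeff-cong = λ {w} {w′} w≋w′ →
        det-cong {A = borderMinor (grid w) (N / m) (N % m)} {B = borderMinor (grid w′) _ _} λ _ _ → entry-cong w≋w′ _
    ; rest-cong  = λ {w} {w′} w≋w′ →
        det-cong {A = borderSquare (grid w) (N / m) (N % m)} {B = borderSquare (grid w′) _ _} λ _ _ → entry-cong w≋w′ _
    }

  system : ∀ N → System N
  system zero    = lift tt
  system (suc N) = system N , step N

  borderDet : ∀ {N} → Vector Carrier N → ℕ → Carrier
  borderDet w t = det R (borderSquare (grid w) (t / m) (t % m))

  borderDet-row-major : ∀ {N} (w : Vector Carrier N) i {j} → j < m →
    borderDet w (m ℕ.* i ℕ.+ j) ≡ det R (borderSquare (grid w) i j)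
  borderDet-row-major w i j<m = ≡.cong₂ (λ r c → det R (borderSquare (grid w) r c)) (row-major-/ i j<m) (row-major-% i j<m)

  eval-system : ∀ {N} (v : Vector Carrier N) q → eval (system N) v q ≈ borderDet v (toℕ (opposite q))
  eval-system {suc N} v zero rewrite toℕ-fromℕ N = begin
    coeff (step N) (tail v) * head v + rest (step N) (tail v)
      ≡⟨ ≡.cong (λ e → coeff (step N) (tail v) * e + rest (step N) (tail v)) (≡.trans (≡.cong (entry v) ij≡N) (entry-head v)) ⟨
    det R (borderMinor (grid (tail v)) i j) * grid v i j + det R (borderSquare (grid (tail v)) i j)
      ≈⟨ borderSquare-expand i j earlier-rows earlier-columns corner≈0 ⟨
    borderDet v N ∎
    where
    open import Relation.Binary.Reasoning.Setoid setoid
    i = N / m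
    j = N % m
    ij≡N = row-major-/%-inverse N m

    earlier-rows : ∀ r c → r < i → c ≤ j → grid v r c ≈ grid (tail v) r c
    earlier-rows r c r<i c≤j = grid-tail v r c (≡.subst (m ℕ.* r ℕ.+ c <_) ij≡N (row-major-<-row j r<i (≤-<-trans c≤j (m%n<n N m))))

    earlier-columns : ∀ c → c < j → grid v i c ≈ grid (tail v) i c
    earlier-columns c c<j = grid-tail v i c (≡.subst (m ℕ.* i ℕ.+ c <_) ij≡N (+-monoʳ-< (m ℕ.* i) c<j))

    corner≈0 : grid (tail v) i j ≈ 0#
    corner≈0 = reflexive (entry-beyond (tail v) (≡.subst (N ≤_) (≡.sym ij≡N) ≤-refl))
  eval-system {suc N} v (suc q) rewrite opposite-suc q = trans (eval-system (tail v) q)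
    (sym (borderSquare-local (t / m) (t % m) λ r c r≤ c≤ → grid-tail v r c
      (≤-<-trans (≡.subst (m ℕ.* r ℕ.+ c ≤_) (row-major-/%-inverse t m) (row-major-mono-≤ m r≤ c≤)) (toℕ<n (opposite q)))))
    where t = toℕ (opposite q)

  admissible⇒borderSquares : ∀ {N} {w : Vector Carrier N} → Admissible (system N) w →
    ∀ i j → j < m → m ℕ.* i ℕ.+ j < N → IsUnit R (det R (borderSquare (grid w) i j))
  admissible⇒borderSquares {w = w} aw i j j<m lt = IsUnit-resp
    (trans (eval-system w q) (reflexive (≡.trans (≡.cong (borderDet w) position) (borderDet-row-major w i j<m))))
    (aw q)
    where
    q = opposite (fromℕ< lt)
    position : toℕ (opposite q) ≡ m ℕ.* i ℕ.+ j
    position = ≡.trans (≡.cong toℕ (opposite-involutive (fromℕ< lt))) (toℕ-fromℕ< lt)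

  borderSquares⇒admissible : ∀ {N} {w : Vector Carrier N} →
    (∀ i j → j < m → m ℕ.* i ℕ.+ j < N → IsUnit R (det R (borderSquare (grid w) i j))) → Admissible (system N) w
  borderSquares⇒admissible {w = w} units q = IsUnit-resp (sym (eval-system w q))
    (units (t / m) (t % m) (m%n<n t m) (≡.subst (_< _) (≡.sym (row-major-/%-inverse t m)) (toℕ<n (opposite q))))
    where t = toℕ (opposite q)

  -- On the border the minor is empty; otherwise it is the border square of the diagonal predecessor.
  borderMinor-unit : ∀ {N} {w : Vector Carrier N} → Admissible (system N) w →
    ∀ i j → j < m → m ℕ.* i ℕ.+ j ≡ N → IsUnit R (det R (borderMinor (grid w) i j))
  borderMinor-unit aw zero    j       _   _      = 1# , *-identityˡ 1#
  borderMinor-unit aw (suc i) zero    _   _      = 1# , *-identityˡ 1#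
  borderMinor-unit aw (suc i) (suc j) j<m ≡.refl =
    admissible⇒borderSquares aw i j (<-trans (n<1+n j) j<m) (row-major-<-row (suc j) (n<1+n i) (<-trans (n<1+n j) j<m))

  regular : ∀ N → Regular (system N)
  regular zero    = lift tt
  regular (suc N) = regular N , λ w aw → borderMinor-unit aw (N / m) (N % m) (m%n<n N m) (row-major-/%-inverse N m)

  module _ (n : ℕ) where
    encode : Matrix R n m → Vector Carrier (n ℕ.* m)
    encode M q = uncurry M (remQuot m (opposite q))

    decode : Vector Carrier (n ℕ.* m) → Matrix R n m
    decode v I J = v (opposite (combine I J))

    grid-decode : ∀ v I J → grid v (toℕ I) (toℕ J) ≡ decode v I J
    grid-decode v I J = ≡.trans
      (≡.cong (entry v) (≡.trans (≡.sym (toℕ-combine I J)) (≡.cong toℕ (≡.sym (opposite-involutive (combine I J))))))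
      (entry-opposite v (opposite (combine I J)))

    decode-encode : ∀ M I J → decode (encode M) I J ≡ M I J
    decode-encode M I J = ≡.cong (uncurry M) (≡.trans (≡.cong (remQuot m) (opposite-involutive (combine I J))) (remQuot-combine I J))

    encode-decode : ∀ v q → encode (decode v) q ≡ v q
    encode-decode v q = ≡.cong v (≡.trans (≡.cong opposite (combine-remQuot {n} m (opposite q))) (opposite-involutive q))

    pascalLike-inverse : Inverse (PascalLikeMatrices R n m) (admissibles (system (n ℕ.* m)))
    pascalLike-inverse = mkInverseₛ
      (λ (M , pl) → encode M , borderSquares⇒admissible λ i j j<m lt →
         pascalLike⇒borderSquares M (grid (encode M)) (λ I J → reflexive (≡.trans (grid-decode (encode M) I J) (decode-encode M I J)))
           pl i j (row-major-<-*⁻¹ i j lt) j<m)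
      (λ (v , av) → decode v , borderSquares⇒pascalLike (decode v) (grid v) (λ I J → reflexive (grid-decode v I J))
         λ i j i<n j<m → admissible⇒borderSquares av i j j<m (row-major-<-* i<n j<m))
      (λ M≈M′ q → M≈M′ _ _)
      (λ v≈v′ I J → v≈v′ _)
      (λ (v , _) q → reflexive (encode-decode v q))
      (λ (M , _) I J → reflexive (decode-encode M I J))

open import Data.Nat using (_*_)
open import Relation.Binary.PropositionalEquality using (setoid)

proposition1 : ∀ {c ℓ : Level} (R : CommutativeRing c ℓ) (u : ℕ) →
    Bijection (Units R) (setoid (Fin u)) →
    (n m : ℕ) → 1 ≤ n → 1 ≤ m →
    Bijection (PascalLikeMatrices R n m) (setoid (Fin (u ^ (n * m))))
proposition1 R u units↔u n m@(suc _) _ _ = Inverse⇒Bijection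
  (inverse (pascalLike-inverse n)
  (inverse (eval-inverse (system (n * m)) (regular (n * m)))
           (vector-inverse-^ (Units R) (Bijection⇒Inverse units↔u) (n * m))))
  where
  open RowMajor R m
  open TriangularSystem R
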